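{- Let $n\ge 11$ and $1\le d\le n-1$ be integers and let $\lambda=(\lambda_1,\dots,\lambda_t)\in\mathbb U^*_{T_{n,d}}$, where $T_{n,d}=\frac{n(n+1)}{2}-d$. If $\lambda_t=2n-2$, then $d=1$, and there is exactly one such partition.
   Context: A partition of $N$ into distinct parts is a sequence of positive integers $\lambda_1<\dots<\lambda_t$ summing to $N$ with $t\ge 2$. Its missing parts are the elements of $\{1,\dots,\lambda_t\}\setminus\{\lambda_1,\dots,\lambda_t\}$. $\lambda$ is refinable if two distinct missing parts sum to a part of $\lambda$, unrefinable otherwise; $\mathbb U_N$ is the set of unrefinable partitions of $N$. $\mathbb U^*_N$ is the set of $\lambda\in\mathbb U_N$ whose largest part is the maximum of the largest parts over all of $\mathbb U_N$. Standing assumption: $n\ge 11$. -}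

module Defs where

open import Data.Nat using (ℕ; _+_; _*_; _∸_; _≤_; _<_; _⊔_)
open import Data.Nat.DivMod using (_/_)
open import Data.List using (List; length; foldr)
open import Data.Nat.ListAction using (sum)
open import Data.List.Relation.Unary.All using (All)
open import Data.List.Relation.Unary.Linked using (Linked)
open import Data.List.Membership.Propositional using (_∈_; _∉_)
open import Data.Product using (Σ; _×_; ∃)
open import Relation.Binary.PropositionalEquality using (_≡_; _≢_)
open import Relation.Nullary using (¬_)

record DistinctPartition (N : ℕ) (λs : List ℕ) : Set where
  field
    increasing : Linked _<_ λs
    positive   : All (λ x → 1 ≤ x) λs
    atLeastTwo : 2 ≤ length λs
    sumIsN     : sum λs ≡ N

-- largest part λ_t (the maximum of the list; equals the last entry
-- for an increasing list)
largest : List ℕ → ℕ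
largest = foldr _⊔_ 0

Missing : List ℕ → ℕ → Set
Missing λs m = 1 ≤ m × m ≤ largest λs × m ∉ λs

Refinable : List ℕ → Set
Refinable λs = Σ ℕ λ a → Σ ℕ λ b →
  a ≢ b × Missing λs a × Missing λs b × (a + b) ∈ λs

Unrefinable : ℕ → List ℕ → Set
Unrefinable N λs = DistinctPartition N λs × ¬ Refinable λs

MaxUnrefinable : ℕ → List ℕ → Set
MaxUnrefinable N λs = Unrefinable N λs ×
  ((μ : List ℕ) → Unrefinable N μ → largest μ ≤ largest λs)

T : ℕ → ℕ → ℕ
T n d = (n * (n + 1)) / 2 ∸ d

module Submission where

-- Write 2n − 2 = M = 2m. All parts lie in [1, M] and M is a part, so for 1 ≤ a < m
-- unrefinability forces a or M − a to be a part: otherwise these two missing parts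
-- would sum to the part M. Folding [0, M] at m, the parts thus sum to at least
-- M + (1 + ⋯ + (m − 1)) = n(n+1)/2 − 1, plus m if m is a part. As the total is
-- n(n+1)/2 − d with d ≥ 1, everything is tight: d = 1, m is not a part, and of each
-- pair exactly the smaller element a is a part, so λ = (1, 2, …, n − 2, 2n − 2).

open import Defs
open import Data.Nat using (ℕ; zero; suc; _+_; _∸_; _*_; _≤_; _<_; z≤n; s≤s; _≟_; _≤?_)
open import Data.Nat.Properties
open import Data.Nat.DivMod using (_/_; m*n/n≡m)
open import Data.Nat.ListAction using (sum)
open import Data.Nat.Tactic.RingSolver using (solve-∀)
open import Data.List using (List; []; _∷_; [_])
open import Data.List.Relation.Unary.All as All using (All; []; _∷_)
open import Data.List.Relation.Unary.All.Properties using (All¬⇒¬Any)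
open import Data.List.Relation.Unary.AllPairs as AllPairs using (AllPairs; []; _∷_)
open import Data.List.Relation.Unary.Any using (here; there)
open import Data.List.Relation.Unary.Linked.Properties using (Linked⇒AllPairs)
open import Data.List.Relation.Unary.Unique.Propositional using (Unique)
open import Data.List.Membership.Propositional using (_∈_; _∉_)
open import Data.List.Membership.DecPropositional _≟_ using (_∈?_)
open import Data.Product using (_×_; _,_; proj₁; proj₂)
open import Data.Sum using (_⊎_; inj₁; inj₂)
open import Data.Empty using (⊥-elim)
open import Relation.Binary.PropositionalEquality
  using (_≡_; refl; sym; trans; cong; cong₂; subst; module ≡-Reasoning)
open import Relation.Nullary using (¬_; Dec; yes; no)
open import Function using (_∘_)

∑< : ℕ → (ℕ → ℕ) → ℕ
∑< zero    f = 0
∑< (suc k) f = ∑< k f + f k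

infix 7 ∑<
syntax ∑< k (λ a → e) = ∑[ a < k ] e

∑-cong : ∀ k {f g} → (∀ a → a < k → f a ≡ g a) → ∑< k f ≡ ∑< k g
∑-cong zero    f≡g = refl
∑-cong (suc k) f≡g =
  cong₂ _+_ (∑-cong k (λ a a<k → f≡g a (m<n⇒m<1+n a<k))) (f≡g k ≤-refl)

∑-mono-≤ : ∀ k {f g} → (∀ a → a < k → f a ≤ g a) → ∑< k f ≤ ∑< k g
∑-mono-≤ zero    f≤g = z≤n
∑-mono-≤ (suc k) f≤g =
  +-mono-≤ (∑-mono-≤ k (λ a a<k → f≤g a (m<n⇒m<1+n a<k))) (f≤g k ≤-refl)

∑-zero : ∀ k {f} → (∀ a → a < k → f a ≡ 0) → ∑< k f ≡ 0
∑-zero zero    f≡0 = refl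
∑-zero (suc k) f≡0 =
  cong₂ _+_ (∑-zero k (λ a a<k → f≡0 a (m<n⇒m<1+n a<k))) (f≡0 k ≤-refl)

∑-distrib-+ : ∀ k f g → ∑[ a < k ] (f a + g a) ≡ ∑< k f + ∑< k g
∑-distrib-+ zero    f g = refl
∑-distrib-+ (suc k) f g =
  trans (cong (_+ (f k + g k)) (∑-distrib-+ k f g)) (interchange (∑< k f) (∑< k g) (f k) (g k))
  where
  interchange : ∀ a b c d → a + b + (c + d) ≡ a + c + (b + d)
  interchange = solve-∀

∑-shift : ∀ k f → ∑< (suc k) f ≡ f 0 + ∑[ a < k ] f (suc a)
∑-shift zero    f = sym (+-identityʳ (f 0))
∑-shift (suc k) f =
  trans (cong (_+ f (suc k)) (∑-shift k f)) (+-assoc (f 0) _ (f (suc k)))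

∑-≤⇒≡ : ∀ k {f g} → (∀ a → a < k → f a ≤ g a) → ∑< k g ≤ ∑< k f →
        ∀ a → a < k → f a ≡ g a
∑-≤⇒≡ (suc k) {f} {g} f≤g ∑g≤∑f a a<1+k with m<1+n⇒m<n∨m≡n a<1+k
... | inj₁ a<k = ∑-≤⇒≡ k f≤g′ ∑kg≤∑kf a a<k
  where
  f≤g′ : ∀ a → a < k → f a ≤ g a
  f≤g′ a a<k = f≤g a (m<n⇒m<1+n a<k)
  ∑kg≤∑kf : ∑< k g ≤ ∑< k f
  ∑kg≤∑kf = +-cancelʳ-≤ (g k) _ _ (≤-trans ∑g≤∑f (+-monoʳ-≤ (∑< k f) (f≤g k ≤-refl)))
... | inj₂ refl = ≤-antisym (f≤g a ≤-refl) ga≤fa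
  where
  ga≤fa : g a ≤ f a
  ga≤fa = +-cancelˡ-≤ (∑< a g) _ _
    (≤-trans ∑g≤∑f (+-monoˡ-≤ (f a) (∑-mono-≤ a (λ b b<a → f≤g b (m<n⇒m<1+n b<a)))))

∑-fold : ∀ m f → ∑[ y < suc (m + m) ] f y ≡ f m + ∑[ a < m ] (f a + f (m + m ∸ a))
∑-fold zero    f = sym (+-identityʳ (f 0))
∑-fold (suc m) f = begin
    ∑< (suc (suc m + suc m)) f
  ≡⟨ cong (λ K → ∑< (suc (suc K)) f) (+-suc m m) ⟩
    ∑< (3 + (m + m)) f
  ≡⟨ ∑-shift (2 + (m + m)) f ⟩
    f 0 + (∑[ y < suc (m + m) ] f (suc y) + f (2 + (m + m)))
  ≡⟨ cong (λ t → f 0 + (t + f (2 + (m + m)))) (∑-fold m (λ y → f (suc y))) ⟩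
    f 0 + (f (suc m) + ∑[ a < m ] (f (suc a) + f (suc (m + m ∸ a))) + f (2 + (m + m)))
  ≡⟨ rearrange (f 0) (f (suc m)) _ _ ⟩
    f (suc m) + (f 0 + f (2 + (m + m)) + ∑[ a < m ] (f (suc a) + f (suc (m + m ∸ a))))
  ≡⟨ cong₂ (λ t u → f (suc m) + (f 0 + f t + u))
           (cong suc (sym (+-suc m m)))
           (∑-cong m (λ a a<m → cong (λ t → f (suc a) + f t) (mirror a<m))) ⟩
    f (suc m) + (f 0 + f (suc m + suc m) + ∑[ a < m ] (f (suc a) + f (suc m + suc m ∸ suc a)))
  ≡⟨ cong (f (suc m) +_) (sym (∑-shift m (λ a → f a + f (suc m + suc m ∸ a)))) ⟩
    f (suc m) + ∑[ a < suc m ] (f a + f (suc m + suc m ∸ a))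
  ∎
  where
  open ≡-Reasoning
  rearrange : ∀ a b c d → a + (b + c + d) ≡ b + (a + d + c)
  rearrange = solve-∀
  mirror : ∀ {a} → a < m → suc (m + m ∸ a) ≡ m + suc m ∸ a
  mirror {a} a<m = trans (sym (+-∸-assoc 1 (≤-trans (<⇒≤ a<m) (m≤m+n m m))))
                         (cong (_∸ a) (sym (+-suc m m)))

∑-suc*2 : ∀ k → (∑[ a < k ] suc a) * 2 ≡ k * suc k
∑-suc*2 zero    = refl
∑-suc*2 (suc k) = begin
    (∑[ a < k ] suc a + suc k) * 2
  ≡⟨ *-distribʳ-+ 2 (∑[ a < k ] suc a) (suc k) ⟩
    (∑[ a < k ] suc a) * 2 + suc k * 2
  ≡⟨ cong (_+ suc k * 2) (∑-suc*2 k) ⟩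
    k * suc k + suc k * 2
  ≡⟨ step k ⟩
    suc k * suc (suc k)
  ∎
  where
  open ≡-Reasoning
  step : ∀ k → k * suc k + suc k * 2 ≡ suc k * suc (suc k)
  step = solve-∀

weight : List ℕ → ℕ → ℕ
weight xs y with y ∈? xs
... | yes _ = y
... | no  _ = 0

weight-∈ : ∀ {xs y} → y ∈ xs → weight xs y ≡ y
weight-∈ {xs} {y} y∈xs with y ∈? xs
... | yes _    = refl
... | no  y∉xs = ⊥-elim (y∉xs y∈xs)

weight-∉ : ∀ {xs y} → y ∉ xs → weight xs y ≡ 0
weight-∉ {xs} {y} y∉xs with y ∈? xs
... | yes y∈xs = ⊥-elim (y∉xs y∈xs)
... | no  _    = refl

weight-∷ : ∀ {x xs} y → x ∉ xs → weight (x ∷ xs) y ≡ weight [ x ] y + weight xs y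
weight-∷ {x} {xs} y x∉xs = by-cases (y ∈? xs) (y ≟ x)
  where
  by-cases : Dec (y ∈ xs) → Dec (y ≡ x) → weight (x ∷ xs) y ≡ weight [ x ] y + weight xs y
  by-cases (yes y∈xs) (yes refl) = ⊥-elim (x∉xs y∈xs)
  by-cases (yes y∈xs) (no y≢x)   =
    trans (weight-∈ {x ∷ xs} (there y∈xs))
          (sym (cong₂ _+_ (weight-∉ {[ x ]} λ { (here y≡x) → y≢x y≡x }) (weight-∈ {xs} y∈xs)))
  by-cases (no y∉xs)  (yes refl) =
    trans (weight-∈ {x ∷ xs} (here refl))
          (sym (trans (cong₂ _+_ (weight-∈ {[ x ]} (here refl)) (weight-∉ {xs} y∉xs))
                      (+-identityʳ y)))
  by-cases (no y∉xs)  (no y≢x)   =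
    trans (weight-∉ {x ∷ xs} λ { (here y≡x) → y≢x y≡x ; (there y∈xs) → y∉xs y∈xs })
          (sym (cong₂ _+_ (weight-∉ {[ x ]} λ { (here y≡x) → y≢x y≡x }) (weight-∉ {xs} y∉xs)))

∑-weight-[_] : ∀ {x} K → x < K → ∑[ y < K ] weight [ x ] y ≡ x
∑-weight-[_] {x} (suc K) x<1+K with m<1+n⇒m<n∨m≡n x<1+K
... | inj₁ x<K  =
  trans (cong₂ _+_ (∑-weight-[_] K x<K)
                   (weight-∉ {[ x ]} {K} λ { (here K≡x) → <-irrefl (sym K≡x) x<K }))
        (+-identityʳ x)
... | inj₂ refl =
  cong₂ _+_ (∑-zero K (λ a a<K → weight-∉ {[ K ]} {a} λ { (here a≡K) → <-irrefl a≡K a<K }))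
            (weight-∈ (here refl))

sum≡∑weight : ∀ K {xs} → Unique xs → All (_< K) xs → sum xs ≡ ∑[ y < K ] weight xs y
sum≡∑weight K {[]}     []           []          = sym (∑-zero K (λ y _ → weight-∉ {[]} {y} λ ()))
sum≡∑weight K {x ∷ xs} (x∉ ∷ uniq) (x<K ∷ xs<K) = begin
    x + sum xs
  ≡⟨ cong₂ _+_ (sym (∑-weight-[_] K x<K)) (sum≡∑weight K uniq xs<K) ⟩
    ∑[ y < K ] weight [ x ] y + ∑[ y < K ] weight xs y
  ≡⟨ sym (∑-distrib-+ K (weight [ x ]) (weight xs)) ⟩
    ∑[ y < K ] (weight [ x ] y + weight xs y)
  ≡⟨ ∑-cong K (λ y _ → sym (weight-∷ y (All¬⇒¬Any x∉))) ⟩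
    ∑[ y < K ] weight (x ∷ xs) y
  ∎
  where open ≡-Reasoning

∈⇒≤largest : ∀ {xs z} → z ∈ xs → z ≤ largest xs
∈⇒≤largest {x ∷ xs} (here refl)  = m≤m⊔n x (largest xs)
∈⇒≤largest {x ∷ xs} (there z∈xs) = ≤-trans (∈⇒≤largest z∈xs) (m≤n⊔m x (largest xs))

largest∈ : ∀ xs → 0 < largest xs → largest xs ∈ xs
largest∈ (x ∷ xs) pos with ⊔-sel x (largest xs)
... | inj₁ top≡x  = here top≡x
... | inj₂ top≡xs = there (subst (_∈ xs) (sym top≡xs) (largest∈ xs (subst (0 <_) top≡xs pos)))

strictlyIncreasing-≡ : ∀ {xs ys} → AllPairs _<_ xs → AllPairs _<_ ys →
  (∀ {z} → z ∈ xs → z ∈ ys) → (∀ {z} → z ∈ ys → z ∈ xs) → xs ≡ ys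
strictlyIncreasing-≡ {[]}    {[]}    _ _ _ _ = refl
strictlyIncreasing-≡ {[]}    {y ∷ _} _ _ _ ys⊆xs with ys⊆xs (here refl)
... | ()
strictlyIncreasing-≡ {x ∷ _} {[]}    _ _ xs⊆ys _ with xs⊆ys (here refl)
... | ()
strictlyIncreasing-≡ {x ∷ xs} {y ∷ ys} (x<xs ∷ ↑xs) (y<ys ∷ ↑ys) xs⊆ys ys⊆xs =
  cong₂ _∷_ x≡y (strictlyIncreasing-≡ ↑xs ↑ys
    (drop-head x≡y x<xs xs⊆ys) (drop-head (sym x≡y) y<ys ys⊆xs))
  where
  x≡y : x ≡ y
  x≡y with xs⊆ys (here refl) | ys⊆xs (here refl)
  ... | here x≡y    | _           = x≡y
  ... | there _     | here y≡x    = sym y≡x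
  ... | there x∈ys  | there y∈xs  = ⊥-elim (<-asym (All.lookup y<ys x∈ys) (All.lookup x<xs y∈xs))
  drop-head : ∀ {u v us vs} → u ≡ v → All (u <_) us →
    (∀ {z} → z ∈ u ∷ us → z ∈ v ∷ vs) → ∀ {z} → z ∈ us → z ∈ vs
  drop-head refl u<us ⊆ z∈us with ⊆ (there z∈us)
  ... | here refl  = ⊥-elim (<-irrefl refl (All.lookup u<us z∈us))
  ... | there z∈vs = z∈vs

unrefinable⇒≤weight-pair : ∀ {xs a b} → ¬ Refinable xs → 1 ≤ a → a < b → b ≤ largest xs →
  a + b ∈ xs → a ≤ weight xs a + weight xs b
unrefinable⇒≤weight-pair {xs} {a} {b} unref 1≤a a<b b≤top a+b∈xs =
  by-cases (a ∈? xs) (b ∈? xs)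
  where
  by-cases : Dec (a ∈ xs) → Dec (b ∈ xs) → a ≤ weight xs a + weight xs b
  by-cases (yes a∈xs) _          = ≤-trans (≤-reflexive (sym (weight-∈ a∈xs))) (m≤m+n _ _)
  by-cases (no _)     (yes b∈xs) =
    ≤-trans (<⇒≤ a<b) (≤-trans (≤-reflexive (sym (weight-∈ b∈xs))) (m≤n+m _ _))
  by-cases (no a∉xs)  (no b∉xs)  = ⊥-elim (unref (a , b , <⇒≢ a<b ,
    (1≤a , ≤-trans (<⇒≤ a<b) b≤top , a∉xs) ,
    (≤-trans 1≤a (<⇒≤ a<b) , b≤top , b∉xs) ,
    a+b∈xs))

weight-pair≡⇒∈×∉ : ∀ {xs a b} → 1 ≤ a → a < b → weight xs a + weight xs b ≡ a →
  a ∈ xs × b ∉ xs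
weight-pair≡⇒∈×∉ {xs} {a} {b} 1≤a a<b pair≡a = by-cases (a ∈? xs) (b ∈? xs)
  where
  by-cases : Dec (a ∈ xs) → Dec (b ∈ xs) → a ∈ xs × b ∉ xs
  by-cases _          (yes b∈xs) = ⊥-elim (<⇒≱ a<b (begin
    b                           ≤⟨ m≤n+m b (weight xs a) ⟩
    weight xs a + b             ≡⟨ cong (weight xs a +_) (sym (weight-∈ b∈xs)) ⟩
    weight xs a + weight xs b   ≡⟨ pair≡a ⟩
    a                           ∎))
    where open ≤-Reasoning
  by-cases (yes a∈xs) (no b∉xs)  = a∈xs , b∉xs
  by-cases (no a∉xs)  (no b∉xs)  = ⊥-elim (<⇒≢ 1≤a (sym (begin
    a                           ≡⟨ sym pair≡a ⟩
    weight xs a + weight xs b   ≡⟨ cong₂ _+_ (weight-∉ a∉xs) (weight-∉ b∉xs) ⟩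
    0                           ∎)))
    where open ≡-Reasoning

m≤m∸n⇒n≡0 : ∀ {m} n → 0 < m → m ≤ m ∸ n → n ≡ 0
m≤m∸n⇒n≡0         zero    _ _  = refl
m≤m∸n⇒n≡0 {suc m} (suc n) _ le = ⊥-elim (<-irrefl refl (≤-trans le (m∸n≤m m n)))

<-mirror : ∀ {a m} → a < m → a < m + m ∸ a
<-mirror {a} {m} a<m = <-≤-trans a<m (begin
  m             ≤⟨ m≤m+n m (m ∸ a) ⟩
  m + (m ∸ a)   ≡⟨ sym (+-∸-assoc m (<⇒≤ a<m)) ⟩
  m + m ∸ a     ∎)
  where open ≤-Reasoning

squeeze : ∀ {x p q s d} → 0 < p → 1 ≤ d → s ≤ q → x + (p + q) ≡ suc (s + p) ∸ d →
  x ≡ 0 × q ≤ s × d ≡ 1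
squeeze {x} {p} {q} {s} {suc e} 0<p _ s≤q total = x≡0 , q≤s , cong suc e≡0
  where
  total≤s+p : x + (p + q) ≤ s + p
  total≤s+p = ≤-trans (≤-reflexive total) (m∸n≤m (s + p) e)
  s+p≤p+q : s + p ≤ p + q
  s+p≤p+q = ≤-trans (≤-reflexive (+-comm s p)) (+-monoʳ-≤ p s≤q)
  x≡0 : x ≡ 0
  x≡0 = n≤0⇒n≡0 (+-cancelʳ-≤ (p + q) x 0 (≤-trans total≤s+p s+p≤p+q))
  q≤s : q ≤ s
  q≤s = +-cancelˡ-≤ p q s
    (≤-trans (m≤n+m (p + q) x) (≤-trans total≤s+p (≤-reflexive (+-comm s p))))
  e≡0 : e ≡ 0
  e≡0 = m≤m∸n⇒n≡0 e (<-≤-trans 0<p (m≤n+m p s))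
    (≤-trans s+p≤p+q (≤-trans (m≤n+m (p + q) x) (≤-reflexive total)))

T-value : ∀ k d → T (2 + k) d ≡ suc (∑[ a < k ] suc a + (suc k + suc k)) ∸ d
T-value k d = cong (_∸ d) (begin
    (2 + k) * (2 + k + 1) / 2
  ≡⟨ cong (_/ 2) (begin
        (2 + k) * (2 + k + 1)
      ≡⟨ expand k ⟩
        k * suc k + (suc k + suc k + 1) * 2
      ≡⟨ cong (_+ (suc k + suc k + 1) * 2) (sym (∑-suc*2 k)) ⟩
        S * 2 + (suc k + suc k + 1) * 2
      ≡⟨ collect S k ⟩
        suc (S + (suc k + suc k)) * 2
      ∎) ⟩
    suc (S + (suc k + suc k)) * 2 / 2
  ≡⟨ m*n/n≡m (suc (S + (suc k + suc k))) 2 ⟩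
    suc (S + (suc k + suc k))
  ∎)
  where
  open ≡-Reasoning
  S : ℕ
  S = ∑[ a < k ] suc a
  expand : ∀ k → (2 + k) * (2 + k + 1) ≡ k * suc k + (suc k + suc k + 1) * 2
  expand = solve-∀
  collect : ∀ S k → S * 2 + (suc k + suc k + 1) * 2 ≡ suc (S + (suc k + suc k)) * 2
  collect = solve-∀

-- The parts of (1, 2, …, n − 2, 2n − 2) for n = k + 2.
CanonicalPart : ℕ → ℕ → Set
CanonicalPart k z = (1 ≤ z × z ≤ k) ⊎ z ≡ suc k + suc k

module _ {k d : ℕ} {xs : List ℕ} (dp : DistinctPartition (T (2 + k) d) xs)
         (unref : ¬ Refinable xs) (top≡ : largest xs ≡ suc k + suc k) (1≤d : 1 ≤ d) where

  open DistinctPartition dp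

  private
    m M : ℕ
    m = suc k
    M = m + m

    pairWeight : ℕ → ℕ
    pairWeight a = weight xs a + weight xs (M ∸ a)

    M∈xs : M ∈ xs
    M∈xs = subst (_∈ xs) top≡ (largest∈ xs (subst (0 <_) (sym top≡) (s≤s z≤n)))

    ∈⇒≤M : ∀ {z} → z ∈ xs → z ≤ M
    ∈⇒≤M z∈xs = subst (_ ≤_) top≡ (∈⇒≤largest z∈xs)

    sum-decomposition : sum xs ≡ weight xs m + (M + ∑[ i < k ] pairWeight (suc i))
    sum-decomposition = begin
        sum xs
      ≡⟨ sum≡∑weight (suc M) unique (All.tabulate (s≤s ∘ ∈⇒≤M)) ⟩
        ∑[ y < suc M ] weight xs y
      ≡⟨ ∑-fold m (weight xs) ⟩
        weight xs m + ∑[ a < m ] pairWeight a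
      ≡⟨ cong (weight xs m +_) (∑-shift k pairWeight) ⟩
        weight xs m + (weight xs 0 + weight xs M + ∑[ i < k ] pairWeight (suc i))
      ≡⟨ cong (λ t → weight xs m + (t + ∑[ i < k ] pairWeight (suc i)))
              (cong₂ _+_ (weight-∉ (n≮0 ∘ All.lookup positive)) (weight-∈ M∈xs)) ⟩
        weight xs m + (M + ∑[ i < k ] pairWeight (suc i))
      ∎
      where
      open ≡-Reasoning
      unique : Unique xs
      unique = AllPairs.map <⇒≢ (Linked⇒AllPairs <-trans increasing)

    pairWeight-≥ : ∀ i → i < k → suc i ≤ pairWeight (suc i)
    pairWeight-≥ i i<k = unrefinable⇒≤weight-pair unref (s≤s z≤n) i<mirror
      (≤-trans (m∸n≤m M (suc i)) (≤-reflexive (sym top≡)))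
      (subst (_∈ xs) (sym (m+[n∸m]≡n (≤-trans (<⇒≤ i<mirror) (m∸n≤m M (suc i))))) M∈xs)
      where
      i<mirror : suc i < M ∸ suc i
      i<mirror = <-mirror (s≤s i<k)

    budget : weight xs m ≡ 0 × ∑[ i < k ] pairWeight (suc i) ≤ ∑[ i < k ] suc i × d ≡ 1
    budget = squeeze (s≤s z≤n) 1≤d (∑-mono-≤ k pairWeight-≥)
      (trans (sym sum-decomposition) (trans sumIsN (T-value k d)))

    pair-parts : ∀ {a} → 1 ≤ a → a < m → a ∈ xs × M ∸ a ∉ xs
    pair-parts {suc i} _ (s≤s i<k) = weight-pair≡⇒∈×∉ (s≤s z≤n) (<-mirror (s≤s i<k))
      (sym (∑-≤⇒≡ k pairWeight-≥ (proj₁ (proj₂ budget)) i i<k))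

  d≡1 : d ≡ 1
  d≡1 = proj₂ (proj₂ budget)

  canonical⇒∈ : ∀ {z} → CanonicalPart k z → z ∈ xs
  canonical⇒∈ (inj₁ (1≤z , z≤k)) = proj₁ (pair-parts 1≤z (s≤s z≤k))
  canonical⇒∈ (inj₂ refl)        = M∈xs

  ∈⇒canonical : ∀ {z} → z ∈ xs → CanonicalPart k z
  ∈⇒canonical {z} z∈xs with z ≤? k | z ≟ m | z ≟ M
  ... | yes z≤k | _        | _        = inj₁ (All.lookup positive z∈xs , z≤k)
  ... | no _    | yes refl | _        =
    ⊥-elim (<⇒≢ (s≤s z≤n) (sym (trans (sym (weight-∈ z∈xs)) (proj₁ budget))))
  ... | no _    | no _     | yes refl = inj₂ refl
  ... | no z≰k  | no z≢m   | no z≢M   = ⊥-elim (proj₂ (pair-parts 1≤a a<m) mirror∈xs)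
    where
    m<z : m < z
    m<z = ≤∧≢⇒< (≰⇒> z≰k) (z≢m ∘ sym)
    z<M : z < M
    z<M = ≤∧≢⇒< (∈⇒≤M z∈xs) z≢M
    1≤a : 1 ≤ M ∸ z
    1≤a = m<n⇒0<n∸m z<M
    a<m : M ∸ z < m
    a<m = <-≤-trans (∸-monoʳ-< m<z (<⇒≤ z<M)) (≤-reflexive (m+n∸n≡m m m))
    mirror∈xs : M ∸ (M ∸ z) ∈ xs
    mirror∈xs = subst (_∈ xs) (sym (m∸[m∸n]≡n (<⇒≤ z<M))) z∈xs

2n∸2≡ : ∀ k → 2 * (2 + k) ∸ 2 ≡ suc k + suc k
2n∸2≡ k = trans (cong (λ t → k + suc (suc t)) (+-identityʳ k)) (+-suc k (suc k))

proposition2p6 : (n d : ℕ) → 11 ≤ n → 1 ≤ d → d ≤ n ∸ 1 →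
    (λs : List ℕ) → MaxUnrefinable (T n d) λs → largest λs ≡ 2 * n ∸ 2 →
    d ≡ 1 ×
    ((μ : List ℕ) → MaxUnrefinable (T n d) μ → largest μ ≡ 2 * n ∸ 2 → μ ≡ λs)
proposition2p6 (suc zero)    d (s≤s ())
proposition2p6 (suc (suc k)) d _ 1≤d _ λs ((dp , unref) , _) top =
  d≡1 dp unref top′ 1≤d , uniqueness
  where
  top′ : largest λs ≡ suc k + suc k
  top′ = trans top (2n∸2≡ k)
  uniqueness : (μ : List ℕ) → MaxUnrefinable (T (2 + k) d) μ →
    largest μ ≡ 2 * (2 + k) ∸ 2 → μ ≡ λs
  uniqueness μ ((dpμ , unrefμ) , _) topμ = strictlyIncreasing-≡
    (Linked⇒AllPairs <-trans (DistinctPartition.increasing dpμ))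
    (Linked⇒AllPairs <-trans (DistinctPartition.increasing dp))
    (canonical⇒∈ dp unref top′ 1≤d ∘ ∈⇒canonical dpμ unrefμ topμ′ 1≤d)
    (canonical⇒∈ dpμ unrefμ topμ′ 1≤d ∘ ∈⇒canonical dp unref top′ 1≤d)
    where
    topμ′ : largest μ ≡ suc k + suc k
    topμ′ = trans topμ (2n∸2≡ k)
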